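{- Consider a partial packing of the three bins $A,B,C$ (all current loads at most $22$) such that $s(A)<4$, $s(C)<4$ and $s(B)\le 9+\tfrac12\bigl(s(A)+s(C)\bigr)$, and suppose the next arriving item $x$ satisfies $s(B)+s(x)>22$. Then there exists an online algorithm that, continuing from this partial packing (starting with the item $x$), packs all remaining items of the input sequence into the three bins so that every bin has load at most $22$.
   Context: Scaled setting of Online Bin Stretching with three bins: items with sizes in $[0,16]$ arrive online one by one and each must be packed immediately and irrevocably into one of three bins $A,B,C$; it is guaranteed that the whole input sequence (items already packed together with all future items) can be packed offline into three bins of capacity $16$. A partial packing is an assignment of each item of some prefix of the input sequence (the items arrived so far) to one of the bins $A,B,C$. For a bin $X$, $s(X)$ denotes the total size of items currently assigned to $X$, and $s(i)$ the size of an item $i$. The online algorithm must handle every possible continuation of the input satisfying the guarantee.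
   Formalization: All item sizes, those already in the partial packing, that of the item $x$ and those of every future item, are rational numbers. -}

module Defs where

open import Data.Bool using (Bool; true; false; if_then_else_)
open import Data.Rational using (ℚ; 0ℚ; _+_; _≤_)
open import Data.Product using (_×_; _,_; proj₁; ∃)
open import Data.List using (List; []; _∷_; length; zip)
open import Data.List.Relation.Unary.All using (All)
open import Relation.Binary.PropositionalEquality using (_≡_)

data Bin : Set where
  A B C : Bin

sameBin : Bin → Bin → Bool
sameBin A A = true
sameBin B B = true
sameBin C C = true
sameBin _ _ = false

-- A (partial) packing: list of (item size, bin it is assigned to).
-- The most recently packed item is at the head of the list.
Packing : Set
Packing = List (ℚ × Bin)

load : Bin → Packing → ℚ
load X [] = 0ℚ
load X ((s , Y) ∷ p) = if sameBin X Y then s + load X p else load X p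

ValidItem : ℚ → Set
ValidItem s = (0ℚ ≤ s) × (s ≤ 16ℚ)
  where
  open import Data.Integer using (+_)
  open import Data.Rational using (_/_)
  16ℚ : ℚ
  16ℚ = + 16 / 1

OfflinePackable : List ℚ → Set
OfflinePackable items =
  ∃ λ (bins : List Bin) →
    (length bins ≡ length items) × (∀ X → load X (zip items bins) ≤ cap)
  where
  open import Data.Integer using (+_)
  open import Data.Rational using (_/_)
  cap : ℚ
  cap = + 16 / 1

-- A deterministic online algorithm: given the current packing (complete
-- history of items packed so far, including the initial partial packing)
-- and the size of the newly arrived item, choose a bin for it.
OnlineAlg : Set
OnlineAlg = Packing → ℚ → Bin

run : OnlineAlg → Packing → List ℚ → Packing
run alg p [] = p
run alg p (i ∷ is) = run alg ((i , alg p i) ∷ p) is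

-- Run First Fit (A, then B, else C) from the given packing.  The first item x
-- overflows B, so it goes to A, and afterwards A carries more than 22 − s(B)
-- beyond its initial load.  An item reaches B only after failing to fit in A,
-- and reaches C only after failing to fit in B; these facts are preserved as an
-- invariant.  An item y ≤ 16 that fits nowhere would then force the total
-- volume above 48 = 3 · 16: if C never grew this is impossible since y + s(C) < 20;
-- if C grew but B did not, the bound s(B) ≤ 9 + (s(A) + s(C))/2 is contradicted;
-- if both grew, A + B > 22 + s(B) > 28 and y + C > 22 already exceed 48.
module Submission where

open import Defs
open import Algebra.Bundles using (CommutativeMonoid)
open import Data.Integer using (+_)
open import Data.Rational using (ℚ; ½; _+_; _*_; _≤_; _<_; _/_; 0ℚ; _≤?_)
open import Data.Rational.Properties
open import Data.Rational.Solver using (module +-*-Solver)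
open +-*-Solver using (solve; _:+_; _:*_; _:=_; con)
open import Data.Product using (_,_; proj₁; ∃)
open import Data.List using (List; []; _∷_; map; _++_; zip; length; foldr)
open import Data.List.Relation.Unary.All as All using (All; []; _∷_)
open import Data.Sum using (_⊎_; inj₁; inj₂; map₂)
open import Relation.Nullary using (yes; no; ¬_; contradiction)
open import Relation.Binary.PropositionalEquality using (_≡_; refl; sym; trans; cong; subst)
import Data.Nat.Properties as ℕ
open import Algebra.Properties.CommutativeSemigroup
  (CommutativeMonoid.commutativeSemigroup +-0-commutativeMonoid) using (x∙yz≈yx∙z)

4ℚ 9ℚ 16ℚ 22ℚ 48ℚ : ℚ
4ℚ = + 4 / 1
9ℚ = + 9 / 1
16ℚ = + 16 / 1
22ℚ = + 22 / 1
48ℚ = + 48 / 1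

p≤p+q : ∀ {p q} → 0ℚ ≤ q → p ≤ p + q
p≤p+q {p} {q} q≥0 = subst (_≤ p + q) (+-identityʳ p) (+-monoʳ-≤ p q≥0)

p≤q+p : ∀ {p q} → 0ℚ ≤ q → p ≤ q + p
p≤q+p {p} {q} q≥0 = subst (p ≤_) (+-comm p q) (p≤p+q q≥0)

excess⇒≮ : ∀ {l r k} → 0ℚ ≤ k → l ≡ r + k → ¬ (l < r)
excess⇒≮ {r = r} k≥0 l≡r+k l<r =
  <-irrefl refl (<-≤-trans l<r (subst (r ≤_) (sym l≡r+k) (p≤p+q k≥0)))

total : List ℚ → ℚ
total = foldr _+_ 0ℚ

total-++ : ∀ xs ys → total (xs ++ ys) ≡ total xs + total ys
total-++ []       ys = sym (+-identityˡ (total ys))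
total-++ (x ∷ xs) ys =
  trans (cong (_+_ x) (total-++ xs ys)) (sym (+-assoc x (total xs) (total ys)))

total-nonneg : ∀ {xs} → All (0ℚ ≤_) xs → 0ℚ ≤ total xs
total-nonneg []            = ≤-refl
total-nonneg (x≥0 ∷ xs≥0) = +-mono-≤ x≥0 (total-nonneg xs≥0)

map-proj₁-zip : ∀ {X Y : Set} (xs : List X) (ys : List Y) →
                length ys ≡ length xs → map proj₁ (zip xs ys) ≡ xs
map-proj₁-zip []       []       _   = refl
map-proj₁-zip (x ∷ xs) (y ∷ ys) len = cong (x ∷_) (map-proj₁-zip xs ys (ℕ.suc-injective len))

load-A+B+C : ∀ p → load A p + load B p + load C p ≡ total (map proj₁ p)
load-A+B+C [] = refl
load-A+B+C ((s , A) ∷ p) rewrite sym (load-A+B+C p) =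
  solve 4 (λ s a b c → s :+ a :+ b :+ c := s :+ (a :+ b :+ c)) refl s (load A p) (load B p) (load C p)
load-A+B+C ((s , B) ∷ p) rewrite sym (load-A+B+C p) =
  solve 4 (λ s a b c → a :+ (s :+ b) :+ c := s :+ (a :+ b :+ c)) refl s (load A p) (load B p) (load C p)
load-A+B+C ((s , C) ∷ p) rewrite sym (load-A+B+C p) =
  solve 4 (λ s a b c → a :+ b :+ (s :+ c) := s :+ (a :+ b :+ c)) refl s (load A p) (load B p) (load C p)

offlinePackable⇒total≤48 : ∀ items → OfflinePackable items → total items ≤ 48ℚ
offlinePackable⇒total≤48 items (bins , length≡ , fits) =
  subst (_≤ 48ℚ) (trans (load-A+B+C (zip items bins)) (cong total (map-proj₁-zip items bins length≡)))
        (+-mono-≤ (+-mono-≤ (fits A) (fits B)) (fits C))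

total-after-first : ∀ (P : Packing) x rest → OfflinePackable (map proj₁ P ++ x ∷ rest) →
                    total (x ∷ map proj₁ P) + total rest ≤ 48ℚ
total-after-first P x rest offline = subst (_≤ 48ℚ)
  (trans (total-++ (map proj₁ P) (x ∷ rest)) (x∙yz≈yx∙z (total (map proj₁ P)) x (total rest)))
  (offlinePackable⇒total≤48 (map proj₁ P ++ x ∷ rest) offline)

run-preserves : (alg : OnlineAlg) (m : ℚ) (Q : Packing → Set) →
  (∀ p y → ValidItem y → total (map proj₁ p) + y ≤ m → Q p → Q ((y , alg p y) ∷ p)) →
  ∀ p rest → All ValidItem rest → total (map proj₁ p) + total rest ≤ m → Q p → Q (run alg p rest)
run-preserves alg m Q step p []         _              _   q = q
run-preserves alg m Q step p (y ∷ rest) (valid-y ∷ valid) ≤m q =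
  run-preserves alg m Q step ((y , alg p y) ∷ p) rest valid
    (subst (_≤ m) (x∙yz≈yx∙z (total (map proj₁ p)) y (total rest)) ≤m)
    (step p y valid-y now≤m q)
  where
  now≤m : total (map proj₁ p) + y ≤ m
  now≤m = ≤-trans (+-monoʳ-≤ (total (map proj₁ p)) (p≤p+q (total-nonneg (All.map proj₁ valid)))) ≤m

firstFit : OnlineAlg
firstFit p y with load A p + y ≤? 22ℚ
... | yes _ = A
... | no _ with load B p + y ≤? 22ℚ
...   | yes _ = B
...   | no _  = C

firstFit-A : ∀ p y → load A p + y ≤ 22ℚ → firstFit p y ≡ A
firstFit-A p y fits with load A p + y ≤? 22ℚ
... | yes _    = refl
... | no ¬fits = contradiction fits ¬fits

module FirstFitInvariant (P : Packing) (a<4 : load A P < 4ℚ) (c<4 : load C P < 4ℚ)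
  (b≤9+½[a+c] : load B P ≤ 9ℚ + ½ * (load A P + load C P)) (b+16>22 : 22ℚ < load B P + 16ℚ) where

  a b c : ℚ
  a = load A P
  b = load B P
  c = load C P

  record Invariant (p : Packing) : Set where
    field
      A≤22 : load A p ≤ 22ℚ
      B≤22 : load B p ≤ 22ℚ
      C≤22 : load C p ≤ 22ℚ
      A-gained>22−b : 22ℚ + a < load A p + b
      b≤B : b ≤ load B p
      c≤C : c ≤ load C p
      B-untouched-or-rejected-by-A : load B p ≤ b ⊎ 22ℚ + b < load B p + load A p
      C-untouched-or-rejected-by-B : load C p ≤ c ⊎ 22ℚ + c < load C p + load B p

  open Invariant

  cannot-overflow-B-and-C : ∀ la lb lc y → y ≤ 16ℚ → la + lb + lc + y ≤ 48ℚ →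
    22ℚ + a < la + b →
    lb ≤ b ⊎ 22ℚ + b < lb + la →
    lc ≤ c ⊎ 22ℚ + c < lc + lb →
    22ℚ < lb + y → ¬ (22ℚ < y + lc)
  cannot-overflow-B-and-C la lb lc y y≤16 _ _ _ (inj₁ lc≤c) _ C-overflow =
    <-asym C-overflow (<-≤-trans (+-mono-≤-< y≤16 (≤-<-trans lc≤c c<4)) (≤ᵇ⇒≤ _))
  cannot-overflow-B-and-C la lb lc y _ ≤48 A-gain (inj₁ lb≤b) (inj₂ C-gain) B-overflow _ =
    excess⇒≮ ≤-refl
      (solve 7 (λ a b c la lb lc y →
         con 22ℚ :+ a :+ (con 22ℚ :+ c) :+ con 22ℚ :+ lb :+ b :+ b :+ (la :+ lb :+ lc :+ y)
         := la :+ b :+ (lc :+ lb) :+ (lb :+ y) :+ b :+ (con 9ℚ :+ con ½ :* (a :+ c))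
              :+ (con 9ℚ :+ con ½ :* (a :+ c)) :+ con 48ℚ :+ con 0ℚ)
         refl a b c la lb lc y)
      (+-mono-<-≤ (+-mono-<-≤ (+-mono-<-≤ (+-mono-<-≤ (+-mono-< (+-mono-< A-gain C-gain) B-overflow)
         lb≤b) b≤9+½[a+c]) b≤9+½[a+c]) ≤48)
  cannot-overflow-B-and-C la lb lc y _ ≤48 _ (inj₂ B-gain) (inj₂ _) _ C-overflow =
    excess⇒≮ (≤ᵇ⇒≤ _)
      (solve 5 (λ b la lb lc y →
         con 22ℚ :+ b :+ con 22ℚ :+ con 22ℚ :+ (la :+ lb :+ lc :+ y)
         := lb :+ la :+ (y :+ lc) :+ (b :+ con 16ℚ) :+ con 48ℚ :+ con (+ 2 / 1))
         refl b la lb lc y)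
      (+-mono-<-≤ (+-mono-< (+-mono-< B-gain C-overflow) b+16>22) ≤48)

  packA : ∀ {p y} → Invariant p → 0ℚ ≤ y → load A p + y ≤ 22ℚ → Invariant ((y , A) ∷ p)
  packA {p} {y} inv y≥0 fits = record
    { A≤22 = subst (_≤ 22ℚ) (+-comm (load A p) y) fits
    ; B≤22 = B≤22 inv
    ; C≤22 = C≤22 inv
    ; A-gained>22−b = <-≤-trans (A-gained>22−b inv) (+-monoˡ-≤ b (p≤q+p y≥0))
    ; b≤B = b≤B inv
    ; c≤C = c≤C inv
    ; B-untouched-or-rejected-by-A =
        map₂ (λ gain → <-≤-trans gain (+-monoʳ-≤ (load B p) (p≤q+p y≥0))) (B-untouched-or-rejected-by-A inv)
    ; C-untouched-or-rejected-by-B = C-untouched-or-rejected-by-B inv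
    }

  packB : ∀ {p y} → Invariant p → 0ℚ ≤ y → 22ℚ < load A p + y → load B p + y ≤ 22ℚ →
          Invariant ((y , B) ∷ p)
  packB {p} {y} inv y≥0 rejected fits = record
    { A≤22 = A≤22 inv
    ; B≤22 = subst (_≤ 22ℚ) (+-comm (load B p) y) fits
    ; C≤22 = C≤22 inv
    ; A-gained>22−b = A-gained>22−b inv
    ; b≤B = ≤-trans (b≤B inv) (p≤q+p y≥0)
    ; c≤C = c≤C inv
    ; B-untouched-or-rejected-by-A = inj₂ (subst (22ℚ + b <_)
        (solve 3 (λ la y lb → la :+ y :+ lb := y :+ lb :+ la) refl (load A p) y (load B p))
        (+-mono-<-≤ rejected (b≤B inv)))
    ; C-untouched-or-rejected-by-B =
        map₂ (λ gain → <-≤-trans gain (+-monoʳ-≤ (load C p) (p≤q+p y≥0))) (C-untouched-or-rejected-by-B inv)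
    }

  packC : ∀ {p y} → Invariant p → 0ℚ ≤ y → 22ℚ < load B p + y → load C p + y ≤ 22ℚ →
          Invariant ((y , C) ∷ p)
  packC {p} {y} inv y≥0 rejected fits = record
    { A≤22 = A≤22 inv
    ; B≤22 = B≤22 inv
    ; C≤22 = subst (_≤ 22ℚ) (+-comm (load C p) y) fits
    ; A-gained>22−b = A-gained>22−b inv
    ; b≤B = b≤B inv
    ; c≤C = ≤-trans (c≤C inv) (p≤q+p y≥0)
    ; B-untouched-or-rejected-by-A = B-untouched-or-rejected-by-A inv
    ; C-untouched-or-rejected-by-B = inj₂ (subst (22ℚ + c <_)
        (solve 3 (λ lb y lc → lb :+ y :+ lc := y :+ lc :+ lb) refl (load B p) y (load C p))
        (+-mono-<-≤ rejected (c≤C inv)))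
    }

  firstFit-preserves : ∀ p y → ValidItem y → total (map proj₁ p) + y ≤ 48ℚ →
                       Invariant p → Invariant ((y , firstFit p y) ∷ p)
  firstFit-preserves p y (y≥0 , y≤16) ≤48 inv with load A p + y ≤? 22ℚ
  ... | yes fitsA = packA inv y≥0 fitsA
  ... | no ¬fitsA with load B p + y ≤? 22ℚ
  ...   | yes fitsB = packB inv y≥0 (≰⇒> ¬fitsA) fitsB
  ...   | no ¬fitsB = packC inv y≥0 (≰⇒> ¬fitsB) (subst (_≤ 22ℚ) (+-comm y (load C p)) fitsC)
    where
    fitsC : y + load C p ≤ 22ℚ
    fitsC = ≮⇒≥ (cannot-overflow-B-and-C (load A p) (load B p) (load C p) y y≤16
              (subst (λ t → t + y ≤ 48ℚ) (sym (load-A+B+C p)) ≤48)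
              (A-gained>22−b inv) (B-untouched-or-rejected-by-A inv) (C-untouched-or-rejected-by-B inv)
              (≰⇒> ¬fitsB))

  fits-A : ∀ {x} → x ≤ 16ℚ → a + x ≤ 22ℚ
  fits-A x≤16 = <⇒≤ (<-≤-trans (+-mono-<-≤ a<4 x≤16) (≤ᵇ⇒≤ _))

  initial : ∀ {x} → (∀ X → load X P ≤ 22ℚ) → 0ℚ ≤ x → x ≤ 16ℚ → 22ℚ < b + x →
            Invariant ((x , A) ∷ P)
  initial {x} bounded x≥0 x≤16 x-overflows-B = record
    { A≤22 = subst (_≤ 22ℚ) (+-comm a x) (fits-A x≤16)
    ; B≤22 = bounded B
    ; C≤22 = bounded C
    ; A-gained>22−b = subst (22ℚ + a <_)
        (solve 3 (λ b x a → b :+ x :+ a := x :+ a :+ b) refl b x a)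
        (+-monoˡ-< a x-overflows-B)
    ; b≤B = ≤-refl
    ; c≤C = ≤-refl
    ; B-untouched-or-rejected-by-A = inj₁ ≤-refl
    ; C-untouched-or-rejected-by-B = inj₁ ≤-refl
    }

  within-22 : ∀ {p} → Invariant p → ∀ X → load X p ≤ 22ℚ
  within-22 inv A = A≤22 inv
  within-22 inv B = B≤22 inv
  within-22 inv C = C≤22 inv

mainTheorem10 : (P : Packing) →
    All (λ p → ValidItem (proj₁ p)) P →
    (∀ X → load X P ≤ + 22 / 1) →
    load A P < + 4 / 1 →
    load C P < + 4 / 1 →
    load B P ≤ + 9 / 1 + ½ * (load A P + load C P) →
    (x : ℚ) → ValidItem x →
    + 22 / 1 < load B P + x →
    ∃ λ (alg : OnlineAlg) →
    (rest : List ℚ) → All ValidItem rest →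
    OfflinePackable (map proj₁ P ++ x ∷ rest) →
    ∀ X → load X (run alg P (x ∷ rest)) ≤ + 22 / 1
mainTheorem10 P _ bounded a<4 c<4 b≤ x (x≥0 , x≤16) x-overflows-B = firstFit , packs
  where
  open FirstFitInvariant P a<4 c<4 b≤ (<-≤-trans x-overflows-B (+-monoʳ-≤ (load B P) x≤16))

  packs : (rest : List ℚ) → All ValidItem rest → OfflinePackable (map proj₁ P ++ x ∷ rest) →
          ∀ X → load X (run firstFit P (x ∷ rest)) ≤ 22ℚ
  packs rest valid offline rewrite firstFit-A P x (fits-A x≤16) =
    within-22 (run-preserves firstFit 48ℚ Invariant firstFit-preserves ((x , A) ∷ P) rest valid
                 (total-after-first P x rest offline) (initial bounded x≥0 x≤16 x-overflows-B))
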